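{- For every integer $d\ge 1$, \[ \sum_{n=1}^{\infty} a^+(n;d)\, q^n = \frac{q^{d^2+d}}{(q;q)_d^2 \, (1+q^d)} \qquad\text{and}\qquad \sum_{n=1}^{\infty} a^-(n;d)\, q^n = \frac{q^{d^2}}{(q;q)_d^2 \,(1+q^d)}. \]
   Context: Every partition of $n$ has a Frobenius symbol $\begin{pmatrix} x_1 & \cdots & x_d\\ y_1&\cdots & y_d\end{pmatrix}$, where $d$ (the number of columns) is the number of dots on the main diagonal of the Ferrers graph, and $x_i$ (resp. $y_i$) is the number of dots in row $i$ to the right of the diagonal (resp. in column $i$ below the diagonal); so $x_1>\cdots>x_d\ge0$, $y_1>\cdots>y_d\ge0$, $\sum_i(x_i+y_i+1)=n$. Column $i$ is positive if $x_i-y_i\ge 1$ and negative if $x_i-y_i\le0$. Parity blocks are maximal sets of contiguous columns of the same sign. For $d\ge1$, $a^+(n;d)$ (resp. $a^-(n;d)$) is the number of partitions of $n$ whose Frobenius symbol has exactly $d$ columns and whose last parity block (equivalently, last column) is positive (resp. negative). $(a;q)_n=(1-a)(1-aq)\cdots(1-aq^{n-1})$. -}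

module Defs where

open import Data.Nat using (ℕ; zero; suc; _+_; _*_; _∸_; _<ᵇ_; _≤ᵇ_; _≡ᵇ_)
open import Data.Bool using (Bool; true; false; _∧_; if_then_else_)
open import Data.List using (List; []; _∷_; map; concatMap; upTo; filterᵇ; length; zipWith; foldr)
open import Data.Vec using (Vec; []; _∷_)
import Data.Vec as V
open import Data.Product using (_×_; _,_; proj₁; proj₂)
open import Data.List using (cartesianProduct)
open import Data.Integer as ℤ using (ℤ; +_; -_)

-- Frobenius symbols with d columns, represented as a pair (x , y) of
-- vectors of length d (top row x₁ … x_d, bottom row y₁ … y_d).

strictDecᵇ : ∀ {d} → Vec ℕ d → Bool
strictDecᵇ [] = true
strictDecᵇ (x ∷ []) = true
strictDecᵇ (x ∷ x' ∷ xs) = (x' <ᵇ x) ∧ strictDecᵇ (x' ∷ xs)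

sumV : ∀ {d} → Vec ℕ d → ℕ
sumV [] = 0
sumV (x ∷ xs) = x + sumV xs

weight : ∀ {d} → Vec ℕ d → Vec ℕ d → ℕ
weight {d} x y = sumV x + sumV y + d

lastPositiveᵇ : ∀ {d} → Vec ℕ d → Vec ℕ d → Bool
lastPositiveᵇ [] [] = false
lastPositiveᵇ (x ∷ []) (y ∷ []) = y <ᵇ x
lastPositiveᵇ (_ ∷ x ∷ xs) (_ ∷ y ∷ ys) = lastPositiveᵇ (x ∷ xs) (y ∷ ys)

lastNegativeᵇ : ∀ {d} → Vec ℕ d → Vec ℕ d → Bool
lastNegativeᵇ [] [] = false
lastNegativeᵇ (x ∷ []) (y ∷ []) = x ≤ᵇ y
lastNegativeᵇ (_ ∷ x ∷ xs) (_ ∷ y ∷ ys) = lastNegativeᵇ (x ∷ xs) (y ∷ ys)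

allVecs : (d b : ℕ) → List (Vec ℕ d)
allVecs zero b = [] ∷ []
allVecs (suc d) b = concatMap (λ v → map (_∷ v) (upTo (suc b))) (allVecs d b)

-- Frobenius symbols of n with d columns (every entry of such a symbol is ≤ n)
isFrobᵇ : (n : ℕ) → ∀ {d} → Vec ℕ d × Vec ℕ d → Bool
isFrobᵇ n (x , y) = strictDecᵇ x ∧ strictDecᵇ y ∧ (weight x y ≡ᵇ n)

frobSymbols : (n d : ℕ) → List (Vec ℕ d × Vec ℕ d)
frobSymbols n d = filterᵇ (isFrobᵇ n) (cartesianProduct (allVecs d n) (allVecs d n))

aPlus : (n d : ℕ) → ℕ
aPlus n d = length (filterᵇ (λ p → lastPositiveᵇ (proj₁ p) (proj₂ p)) (frobSymbols n d))

aMinus : (n d : ℕ) → ℕ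
aMinus n d = length (filterᵇ (λ p → lastNegativeᵇ (proj₁ p) (proj₂ p)) (frobSymbols n d))

Series : Set
Series = ℕ → ℤ

sumℤ : List ℤ → ℤ
sumℤ = foldr ℤ._+_ (+ 0)

oneₛ : Series
oneₛ zero = + 1
oneₛ (suc n) = + 0

qPow : ℕ → Series
qPow k n = if k ≡ᵇ n then + 1 else + 0

_+ₛ_ : Series → Series → Series
(f +ₛ g) n = f n ℤ.+ g n

_-ₛ_ : Series → Series → Series
(f -ₛ g) n = f n ℤ.- g n

_*ₛ_ : Series → Series → Series
(f *ₛ g) n = sumℤ (map (λ k → f k ℤ.* g (n ∸ k)) (upTo (suc n)))

infixl 7 _*ₛ_
infixl 6 _+ₛ_ _-ₛ_

qPoch : ℕ → Series
qPoch zero = oneₛ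
qPoch (suc d) = qPoch d *ₛ (oneₛ -ₛ qPow (suc d))

-- Multiplicative inverse of a series f with constant term 1:
-- g₀ = 1, g_{n+1} = − Σ_{k=1}^{n+1} f_k g_{n+1−k}.
-- invList f n = [g_n , g_{n−1} , … , g₀]
invList : Series → ℕ → List ℤ
invList f zero = + 1 ∷ []
invList f (suc n) =
  (- sumℤ (zipWith ℤ._*_ (map (λ j → f (suc j)) (upTo (suc n))) (invList f n)))
  ∷ invList f n

headℤ : List ℤ → ℤ
headℤ [] = + 0
headℤ (x ∷ _) = x

invₛ : Series → Series
invₛ f n = headℤ (invList f n)

genPlus : ℕ → Series
genPlus d zero = + 0
genPlus d (suc n) = + aPlus (suc n) d

genMinus : ℕ → Series
genMinus d zero = + 0
genMinus d (suc n) = + aMinus (suc n) d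

module Submission where

-- Let distinct d = Σ q^|v| over strictly
-- decreasing v ∈ ℕ^d, and symbols± = Σ q^(|x|+|y|) over pairs of such rows
-- whose last column is positive/negative, so that Σₙ a±(n;d) qⁿ = q^d symbols±.
-- Three bijections give the proof:
--   (1) distinct (d+1) = q^(d+1) distinct (d+1) + q^d distinct d (is the last
--       part 0?), whence (q;q)_d distinct d = q^(d(d−1)/2);
--   (2) symbols⁺ = q^d symbols⁻, via (x , y) ↦ (y , x − 1);
--   (3) symbols⁺ + symbols⁻ = distinct d ², as every column has a sign.
-- So (q;q)_d² (1 + q^d) symbols⁻ = q^(d(d−1)), and dividing gives the theorem.

open import Defs
open import Data.Nat using (ℕ; _≤_; _+_; _*_)
open import Data.Product using (_×_)
open import Relation.Binary.PropositionalEquality using (_≡_)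

open import Data.Nat
open import Data.Nat.Properties
open import Data.Nat.Tactic.RingSolver using () renaming (solve-∀ to ℕ-solve)
open import Data.Integer as ℤ using (ℤ; 0ℤ; 1ℤ; -_)
import Data.Integer.Properties as ℤP
open import Data.Integer.Tactic.RingSolver using () renaming (solve-∀ to ℤ-solve)
open import Data.Bool using (Bool; true; false; _∧_; not)
open import Data.Bool.Properties using (∧-assoc; ∧-zeroʳ; ∧-conicalʳ)
open import Data.List
  using (List; []; _∷_; map; upTo; applyUpTo; concatMap; _++_; zipWith; filterᵇ; length; cartesianProduct)
import Data.List.Properties as List
open import Data.Vec using (Vec; []; _∷_; _∷ʳ_)
import Data.Vec as Vec
open import Data.Product using (_,_; proj₁; proj₂)
open import Function using (_∘_; id)
open import Relation.Binary.PropositionalEquality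
import Relation.Binary.Reasoning.Setoid as SetoidReasoning

χ : Bool → ℕ
χ true  = 1
χ false = 0

χ-∧ : ∀ a b → χ (a ∧ b) ≡ χ a * χ b
χ-∧ true  b = sym (+-identityʳ (χ b))
χ-∧ false b = refl

split-χ : ∀ x b → x ≡ x * χ b + x * χ (not b)
split-χ x true  = identity x
  where
  identity : ∀ x → x ≡ x * 1 + x * 0
  identity = ℕ-solve
split-χ x false = identity x
  where
  identity : ∀ x → x ≡ x * 0 + x * 1
  identity = ℕ-solve

ΣL : {A : Set} → List A → (A → ℕ) → ℕ
ΣL []       f = 0
ΣL (x ∷ xs) f = f x + ΣL xs f

Σ< : ℕ → (ℕ → ℕ) → ℕ
Σ< zero    f = 0
Σ< (suc m) f = f 0 + Σ< m (f ∘ suc)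

module _ {A : Set} where

  ΣL-cong : ∀ (xs : List A) {f g} → (∀ x → f x ≡ g x) → ΣL xs f ≡ ΣL xs g
  ΣL-cong []       f≗g = refl
  ΣL-cong (x ∷ xs) f≗g = cong₂ _+_ (f≗g x) (ΣL-cong xs f≗g)

  ΣL-zero : ∀ (xs : List A) f → (∀ x → f x ≡ 0) → ΣL xs f ≡ 0
  ΣL-zero []       f f≗0 = refl
  ΣL-zero (x ∷ xs) f f≗0 = cong₂ _+_ (f≗0 x) (ΣL-zero xs f f≗0)

  ΣL-++ : ∀ (xs ys : List A) f → ΣL (xs ++ ys) f ≡ ΣL xs f + ΣL ys f
  ΣL-++ []       ys f = refl
  ΣL-++ (x ∷ xs) ys f = trans (cong (f x +_) (ΣL-++ xs ys f)) (sym (+-assoc (f x) _ _))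

  ΣL-+ : ∀ (xs : List A) f g → ΣL xs (λ x → f x + g x) ≡ ΣL xs f + ΣL xs g
  ΣL-+ []       f g = refl
  ΣL-+ (x ∷ xs) f g = trans (cong (f x + g x +_) (ΣL-+ xs f g)) (regroup (f x) (g x) _ _)
    where
    regroup : ∀ a b c d → a + b + (c + d) ≡ a + c + (b + d)
    regroup = ℕ-solve

  ΣL-*ˡ : ∀ (xs : List A) c f → c * ΣL xs f ≡ ΣL xs (λ x → c * f x)
  ΣL-*ˡ []       c f = *-zeroʳ c
  ΣL-*ˡ (x ∷ xs) c f = trans (*-distribˡ-+ c (f x) _) (cong (c * f x +_) (ΣL-*ˡ xs c f))

  ΣL-*ʳ : ∀ (xs : List A) c f → ΣL xs f * c ≡ ΣL xs (λ x → f x * c)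
  ΣL-*ʳ xs c f = trans (*-comm _ c) (trans (ΣL-*ˡ xs c f) (ΣL-cong xs (λ x → *-comm c (f x))))

  ΣL-filter : ∀ (p : A → Bool) (xs : List A) f →
    ΣL (filterᵇ p xs) f ≡ ΣL xs (λ x → χ (p x) * f x)
  ΣL-filter p []       f = refl
  ΣL-filter p (x ∷ xs) f with p x
  ... | true  = cong₂ _+_ (sym (+-identityʳ (f x))) (ΣL-filter p xs f)
  ... | false = ΣL-filter p xs f

  length≡ΣL : ∀ (xs : List A) → length xs ≡ ΣL xs (λ _ → 1)
  length≡ΣL []       = refl
  length≡ΣL (x ∷ xs) = cong suc (length≡ΣL xs)

ΣL-map : ∀ {A B : Set} (g : A → B) xs f → ΣL (map g xs) f ≡ ΣL xs (f ∘ g)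
ΣL-map g []       f = refl
ΣL-map g (x ∷ xs) f = cong (f (g x) +_) (ΣL-map g xs f)

ΣL-concatMap : ∀ {A B : Set} (g : A → List B) xs f →
  ΣL (concatMap g xs) f ≡ ΣL xs (λ x → ΣL (g x) f)
ΣL-concatMap g []       f = refl
ΣL-concatMap g (x ∷ xs) f =
  trans (ΣL-++ (g x) (concatMap g xs) f) (cong (ΣL (g x) f +_) (ΣL-concatMap g xs f))

ΣL-swap : ∀ {A B : Set} (xs : List A) (ys : List B) (f : A → B → ℕ) →
  ΣL xs (λ x → ΣL ys (f x)) ≡ ΣL ys (λ y → ΣL xs (λ x → f x y))
ΣL-swap []       ys f = sym (ΣL-zero ys (λ _ → 0) (λ _ → refl))
ΣL-swap (x ∷ xs) ys f =
  trans (cong (ΣL ys (f x) +_) (ΣL-swap xs ys f)) (sym (ΣL-+ ys (f x) _))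

ΣL-cartesianProduct : ∀ {A B : Set} (xs : List A) (ys : List B) f →
  ΣL (cartesianProduct xs ys) f ≡ ΣL xs (λ x → ΣL ys (λ y → f (x , y)))
ΣL-cartesianProduct []       ys f = refl
ΣL-cartesianProduct (x ∷ xs) ys f =
  trans (ΣL-++ (map (x ,_) ys) _ f)
        (cong₂ _+_ (ΣL-map (x ,_) ys f) (ΣL-cartesianProduct xs ys f))

ΣL-upTo : ∀ m f → ΣL (upTo m) f ≡ Σ< m f
ΣL-upTo m f = ΣL-applyUpTo id m
  where
  ΣL-applyUpTo : ∀ h m → ΣL (applyUpTo h m) f ≡ Σ< m (f ∘ h)
  ΣL-applyUpTo h zero    = refl
  ΣL-applyUpTo h (suc m) = cong (f (h 0) +_) (ΣL-applyUpTo (h ∘ suc) m)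

Σ<-cong : ∀ m {f g} → (∀ i → i < m → f i ≡ g i) → Σ< m f ≡ Σ< m g
Σ<-cong zero    f≗g = refl
Σ<-cong (suc m) f≗g = cong₂ _+_ (f≗g 0 (s≤s z≤n)) (Σ<-cong m (λ i i<m → f≗g (suc i) (s≤s i<m)))

Σ<-zero : ∀ m f → (∀ i → f i ≡ 0) → Σ< m f ≡ 0
Σ<-zero m f f≗0 = trans (sym (ΣL-upTo m f)) (ΣL-zero (upTo m) f f≗0)

Σ<-*ˡ : ∀ m c f → c * Σ< m f ≡ Σ< m (λ i → c * f i)
Σ<-*ˡ m c f = trans (cong (c *_) (sym (ΣL-upTo m f)))
                (trans (ΣL-*ˡ (upTo m) c f) (ΣL-upTo m (λ i → c * f i)))

Σ<-head : ∀ m f → (∀ i → f (suc i) ≡ 0) → Σ< (suc m) f ≡ f 0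
Σ<-head m f tail≡0 = trans (cong (f 0 +_) (Σ<-zero m (f ∘ suc) tail≡0)) (+-identityʳ (f 0))

Σ<-extend : ∀ m k f → (∀ i → m ≤ i → f i ≡ 0) → Σ< (m + k) f ≡ Σ< m f
Σ<-extend zero    k f f≡0 = Σ<-zero k f (λ i → f≡0 i z≤n)
Σ<-extend (suc m) k f f≡0 = cong (f 0 +_) (Σ<-extend m k (f ∘ suc) (λ i m≤i → f≡0 (suc i) (s≤s m≤i)))

ΣL-Σ<-swap : ∀ {A : Set} (xs : List A) m (f : A → ℕ → ℕ) →
  ΣL xs (λ x → Σ< m (f x)) ≡ Σ< m (λ i → ΣL xs (λ x → f x i))
ΣL-Σ<-swap xs m f =
  trans (ΣL-cong xs (λ x → sym (ΣL-upTo m (f x))))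
        (trans (ΣL-swap xs (upTo m) f) (ΣL-upTo m (λ i → ΣL xs (λ x → f x i))))

ΣV : (d b : ℕ) → (Vec ℕ d → ℕ) → ℕ
ΣV d b = ΣL (allVecs d b)

ΣV-cons : ∀ d b f → ΣV (suc d) b f ≡ ΣV d b (λ v → Σ< (suc b) (λ i → f (i ∷ v)))
ΣV-cons d b f = trans (ΣL-concatMap _ (allVecs d b) f)
  (ΣL-cong (allVecs d b) (λ v → trans (ΣL-map (_∷ v) (upTo (suc b)) f) (ΣL-upTo (suc b) _)))

ΣV-snoc : ∀ d b f → ΣV (suc d) b f ≡ Σ< (suc b) (λ j → ΣV d b (λ v → f (v ∷ʳ j)))
ΣV-snoc zero    b f = trans (ΣV-cons zero b f)
  (trans (+-identityʳ _) (Σ<-cong (suc b) (λ j _ → sym (+-identityʳ (f (j ∷ []))))))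
ΣV-snoc (suc d) b f = begin
    ΣV (suc (suc d)) b f
  ≡⟨ ΣV-cons (suc d) b f ⟩
    ΣV (suc d) b (λ v → Σ< (suc b) (λ i → f (i ∷ v)))
  ≡⟨ ΣV-snoc d b _ ⟩
    Σ< (suc b) (λ j → ΣV d b (λ u → Σ< (suc b) (λ i → f (i ∷ (u ∷ʳ j)))))
  ≡⟨ Σ<-cong (suc b) (λ j _ → sym (ΣV-cons d b (λ w → f (w ∷ʳ j)))) ⟩
    Σ< (suc b) (λ j → ΣV (suc d) b (λ v → f (v ∷ʳ j))) ∎
  where open ≡-Reasoning

ΣV-bound : ∀ d b k f → (∀ v → b < sumV v → f v ≡ 0) → ΣV d (b + k) f ≡ ΣV d b f
ΣV-bound zero    b k f f≡0 = refl
ΣV-bound (suc d) b k f f≡0 = begin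
    ΣV (suc d) (b + k) f
  ≡⟨ ΣV-cons d (b + k) f ⟩
    ΣV d (b + k) (λ v → Σ< (suc b + k) (λ i → f (i ∷ v)))
  ≡⟨ ΣL-cong (allVecs d (b + k)) (λ v → Σ<-extend (suc b) k (λ i → f (i ∷ v))
       (λ i b<i → f≡0 (i ∷ v) (<-≤-trans b<i (m≤m+n i (sumV v))))) ⟩
    ΣV d (b + k) (λ v → Σ< (suc b) (λ i → f (i ∷ v)))
  ≡⟨ ΣV-bound d b k _ (λ v b<v → Σ<-zero (suc b) _
       (λ i → f≡0 (i ∷ v) (<-≤-trans b<v (m≤n+m (sumV v) i)))) ⟩
    ΣV d b (λ v → Σ< (suc b) (λ i → f (i ∷ v)))
  ≡⟨ ΣV-cons d b f ⟨
    ΣV (suc d) b f ∎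
  where open ≡-Reasoning

noZero : ∀ {d} → Vec ℕ d → Bool
noZero []       = true
noZero (x ∷ v) = (0 <ᵇ x) ∧ noZero v

ΣV-shift : ∀ d b f → (∀ v → noZero v ≡ false → f v ≡ 0) →
  ΣV d (suc b) f ≡ ΣV d b (f ∘ Vec.map suc)
ΣV-shift zero    b f f≡0 = refl
ΣV-shift (suc d) b f f≡0 = begin
    ΣV (suc d) (suc b) f
  ≡⟨ ΣV-cons d (suc b) f ⟩
    ΣV d (suc b) (λ v → f (0 ∷ v) + Σ< (suc b) (λ i → f (suc i ∷ v)))
  ≡⟨ ΣL-cong (allVecs d (suc b)) (λ v → cong (_+ Σ< (suc b) (λ i → f (suc i ∷ v))) (f≡0 (0 ∷ v) refl)) ⟩
    ΣV d (suc b) (λ v → Σ< (suc b) (λ i → f (suc i ∷ v)))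
  ≡⟨ ΣV-shift d b _ (λ v zero∈v → Σ<-zero (suc b) _ (λ i → f≡0 (suc i ∷ v) zero∈v)) ⟩
    ΣV d b (λ v → Σ< (suc b) (λ i → f (suc i ∷ Vec.map suc v)))
  ≡⟨ ΣV-cons d b (f ∘ Vec.map suc) ⟨
    ΣV (suc d) b (f ∘ Vec.map suc) ∎
  where open ≡-Reasoning

strictDecᵇ-map-suc : ∀ {d} (v : Vec ℕ d) → strictDecᵇ (Vec.map suc v) ≡ strictDecᵇ v
strictDecᵇ-map-suc []           = refl
strictDecᵇ-map-suc (x ∷ [])     = refl
strictDecᵇ-map-suc (x ∷ y ∷ ys) = cong ((y <ᵇ x) ∧_) (strictDecᵇ-map-suc (y ∷ ys))

sumV-map-suc : ∀ {d} (v : Vec ℕ d) → sumV (Vec.map suc v) ≡ d + sumV v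
sumV-map-suc []               = refl
sumV-map-suc {suc d} (x ∷ v) = begin
    suc x + sumV (Vec.map suc v)  ≡⟨ cong (suc x +_) (sumV-map-suc v) ⟩
    suc x + (d + sumV v)          ≡⟨ cong suc (x+[d+s]≡d+[x+s] x d (sumV v)) ⟩
    suc d + (x + sumV v)          ∎
  where
  open ≡-Reasoning
  x+[d+s]≡d+[x+s] : ∀ x d s → x + (d + s) ≡ d + (x + s)
  x+[d+s]≡d+[x+s] = ℕ-solve

noZero-map-suc : ∀ {d} (v : Vec ℕ d) → noZero (Vec.map suc v) ≡ true
noZero-map-suc []      = refl
noZero-map-suc (x ∷ v) = noZero-map-suc v

sumV-snoc : ∀ {d} (v : Vec ℕ d) j → sumV (v ∷ʳ j) ≡ sumV v + j
sumV-snoc []      j = +-identityʳ j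
sumV-snoc (x ∷ v) j = trans (cong (x +_) (sumV-snoc v j)) (sym (+-assoc x (sumV v) j))

strictDecᵇ-snoc-0 : ∀ {d} (v : Vec ℕ d) → strictDecᵇ (v ∷ʳ 0) ≡ strictDecᵇ v ∧ noZero v
strictDecᵇ-snoc-0 []               = refl
strictDecᵇ-snoc-0 (x ∷ [])         = refl
strictDecᵇ-snoc-0 (zero ∷ y ∷ ys)  = refl
strictDecᵇ-snoc-0 (suc x ∷ y ∷ ys) =
  trans (cong ((y <ᵇ suc x) ∧_) (strictDecᵇ-snoc-0 (y ∷ ys)))
        (sym (∧-assoc (y <ᵇ suc x) (strictDecᵇ (y ∷ ys)) (noZero (y ∷ ys))))

noZero-snoc-0 : ∀ {d} (v : Vec ℕ d) → noZero (v ∷ʳ 0) ≡ false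
noZero-snoc-0 []      = refl
noZero-snoc-0 (x ∷ v) = trans (cong ((0 <ᵇ x) ∧_) (noZero-snoc-0 v)) (∧-zeroʳ _)

strictDecᵇ-snoc-suc : ∀ {d} (v : Vec ℕ d) j →
  strictDecᵇ (v ∷ʳ suc j) ≡ true → noZero (v ∷ʳ suc j) ≡ true
strictDecᵇ-snoc-suc []                 j dec = refl
strictDecᵇ-snoc-suc (zero ∷ [])        j ()
strictDecᵇ-snoc-suc (suc x ∷ [])       j dec = refl
strictDecᵇ-snoc-suc (zero ∷ y ∷ ys)    j ()
strictDecᵇ-snoc-suc (suc x ∷ y ∷ ys)   j dec =
  strictDecᵇ-snoc-suc (y ∷ ys) j (∧-conicalʳ (y <ᵇ suc x) _ dec)

<ᵇ-suc : ∀ a b → (a <ᵇ suc b) ≡ (a ≤ᵇ b)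
<ᵇ-suc zero    b = refl
<ᵇ-suc (suc a) b = refl

column-dichotomy : ∀ a b → χ (b <ᵇ a) + χ (a ≤ᵇ b) ≡ 1
column-dichotomy zero    b       = refl
column-dichotomy (suc a) zero    = refl
column-dichotomy (suc a) (suc b) =
  trans (cong (λ t → χ (b <ᵇ a) + χ t) (<ᵇ-suc a b)) (column-dichotomy a b)

lastPositive-or-lastNegative : ∀ {d} (x y : Vec ℕ (suc d)) →
  χ (lastPositiveᵇ x y) + χ (lastNegativeᵇ x y) ≡ 1
lastPositive-or-lastNegative (a ∷ [])     (b ∷ [])     = column-dichotomy a b
lastPositive-or-lastNegative (_ ∷ a ∷ xs) (_ ∷ b ∷ ys) = lastPositive-or-lastNegative (a ∷ xs) (b ∷ ys)

lastPositive-map-suc : ∀ {d} (x y : Vec ℕ (suc d)) →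
  lastPositiveᵇ (Vec.map suc x) y ≡ lastNegativeᵇ y x
lastPositive-map-suc (a ∷ [])     (b ∷ [])     = <ᵇ-suc b a
lastPositive-map-suc (_ ∷ a ∷ xs) (_ ∷ b ∷ ys) = lastPositive-map-suc (a ∷ xs) (b ∷ ys)

-- In a strictly decreasing top row containing 0, the last entry is 0, so the
-- last column cannot be positive.
lastPositive-noZero : ∀ {d} (x y : Vec ℕ (suc d)) →
  strictDecᵇ x ≡ true → noZero x ≡ false → lastPositiveᵇ x y ≡ false
lastPositive-noZero (zero ∷ [])          (b ∷ [])      dec zero∈x = refl
lastPositive-noZero (suc a ∷ [])         (b ∷ [])      dec ()
lastPositive-noZero (zero ∷ a′ ∷ xs)     (_ ∷ b ∷ ys)  ()  zero∈x
lastPositive-noZero (suc a ∷ a′ ∷ xs)    (_ ∷ b ∷ ys)  dec zero∈x =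
  lastPositive-noZero (a′ ∷ xs) (b ∷ ys) (∧-conicalʳ (a′ <ᵇ suc a) _ dec) zero∈x

module ≗-Reasoning = SetoidReasoning (ℕ →-setoid ℤ)

tail : Series → Series
tail f n = f (suc n)

-- It is easier to reason about
-- than the Defs product _*ₛ_, with which it agrees (*ₛ≗⊛).
infixl 7 _⊛_
_⊛_ : Series → Series → Series
(f ⊛ g) zero    = f 0 ℤ.* g 0
(f ⊛ g) (suc n) = f 0 ℤ.* g (suc n) ℤ.+ (tail f ⊛ g) n

convolution-sum : ∀ f g n →
  sumℤ (applyUpTo (λ k → f k ℤ.* g (n ∸ k)) (suc n)) ≡ (f ⊛ g) n
convolution-sum f g zero    = ℤP.+-identityʳ (f 0 ℤ.* g 0)
convolution-sum f g (suc n) = cong (ℤ._+_ (f 0 ℤ.* g (suc n))) (convolution-sum (tail f) g n)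

*ₛ≗⊛ : ∀ f g → f *ₛ g ≗ f ⊛ g
*ₛ≗⊛ f g n = trans (cong sumℤ (List.map-upTo (λ k → f k ℤ.* g (n ∸ k)) (suc n))) (convolution-sum f g n)

⊛-cong : ∀ {f f′ g g′} → f ≗ f′ → g ≗ g′ → f ⊛ g ≗ f′ ⊛ g′
⊛-cong f≗f′ g≗g′ zero    = cong₂ ℤ._*_ (f≗f′ 0) (g≗g′ 0)
⊛-cong f≗f′ g≗g′ (suc n) =
  cong₂ ℤ._+_ (cong₂ ℤ._*_ (f≗f′ 0) (g≗g′ (suc n))) (⊛-cong (f≗f′ ∘ suc) g≗g′ n)

⊛-identityˡ : ∀ g → oneₛ ⊛ g ≗ g
⊛-identityˡ g zero    = ℤP.*-identityˡ (g 0)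
⊛-identityˡ g (suc n) =
  trans (cong₂ ℤ._+_ (ℤP.*-identityˡ (g (suc n))) (zero-⊛ (λ _ → refl) n))
        (ℤP.+-identityʳ (g (suc n)))
  where
  zero-⊛ : ∀ {f} → (∀ k → f k ≡ 0ℤ) → ∀ m → (f ⊛ g) m ≡ 0ℤ
  zero-⊛ {f} f≡0 zero    = trans (cong (ℤ._* g 0) (f≡0 0)) (ℤP.*-zeroˡ (g 0))
  zero-⊛ {f} f≡0 (suc m) =
    cong₂ ℤ._+_ (trans (cong (ℤ._* g (suc m)) (f≡0 0)) (ℤP.*-zeroˡ (g (suc m))))
                (zero-⊛ (f≡0 ∘ suc) m)

⊛-distribʳ-+ : ∀ f g h → (f +ₛ g) ⊛ h ≗ f ⊛ h +ₛ g ⊛ h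
⊛-distribʳ-+ f g h zero    = ℤP.*-distribʳ-+ (h 0) (f 0) (g 0)
⊛-distribʳ-+ f g h (suc n) =
  trans (cong (ℤ._+_ ((f 0 ℤ.+ g 0) ℤ.* h (suc n))) (⊛-distribʳ-+ (tail f) (tail g) h n))
        (regroup (f 0) (g 0) (h (suc n)) _ _)
  where
  regroup : ∀ a b c x y → (a ℤ.+ b) ℤ.* c ℤ.+ (x ℤ.+ y) ≡ (a ℤ.* c ℤ.+ x) ℤ.+ (b ℤ.* c ℤ.+ y)
  regroup = ℤ-solve

⊛-distribʳ-- : ∀ f g h → (f -ₛ g) ⊛ h ≗ f ⊛ h -ₛ g ⊛ h
⊛-distribʳ-- f g h zero    = distrib (f 0) (g 0) (h 0)
  where
  distrib : ∀ a b c → (a ℤ.- b) ℤ.* c ≡ a ℤ.* c ℤ.- b ℤ.* c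
  distrib = ℤ-solve
⊛-distribʳ-- f g h (suc n) =
  trans (cong (ℤ._+_ ((f 0 ℤ.- g 0) ℤ.* h (suc n))) (⊛-distribʳ-- (tail f) (tail g) h n))
        (regroup (f 0) (g 0) (h (suc n)) _ _)
  where
  regroup : ∀ a b c x y → (a ℤ.- b) ℤ.* c ℤ.+ (x ℤ.- y) ≡ (a ℤ.* c ℤ.+ x) ℤ.- (b ℤ.* c ℤ.+ y)
  regroup = ℤ-solve

-- Scalar multiples, needed to unfold tail (f ⊛ g) in the associativity proof.
_·ₛ_ : ℤ → Series → Series
(c ·ₛ f) n = c ℤ.* f n

⊛-scaleˡ : ∀ c f g → (c ·ₛ f) ⊛ g ≗ c ·ₛ (f ⊛ g)
⊛-scaleˡ c f g zero    = ℤP.*-assoc c (f 0) (g 0)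
⊛-scaleˡ c f g (suc n) =
  trans (cong (ℤ._+_ (c ℤ.* f 0 ℤ.* g (suc n))) (⊛-scaleˡ c (tail f) g n))
        (factor c (f 0) (g (suc n)) _)
  where
  factor : ∀ a b x y → a ℤ.* b ℤ.* x ℤ.+ a ℤ.* y ≡ a ℤ.* (b ℤ.* x ℤ.+ y)
  factor = ℤ-solve

⊛-ℕ : ∀ (f g : ℕ → ℕ) n →
  ((ℤ.+_ ∘ f) ⊛ (ℤ.+_ ∘ g)) n ≡ ℤ.+ Σ< (suc n) (λ k → f k * g (n ∸ k))
⊛-ℕ f g zero    = trans (sym (ℤP.pos-* (f 0) (g 0))) (cong ℤ.+_ (sym (+-identityʳ _)))
⊛-ℕ f g (suc n) =
  trans (cong₂ ℤ._+_ (sym (ℤP.pos-* (f 0) (g (suc n)))) (⊛-ℕ (f ∘ suc) g n))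
        (sym (ℤP.pos-+ (f 0 * g (suc n)) _))

-- Commutativity: unfolding both sides twice meets in the middle at
-- tail f ⊛ tail g.
⊛-comm : ∀ f g → f ⊛ g ≗ g ⊛ f
⊛-comm f g zero          = ℤP.*-comm (f 0) (g 0)
⊛-comm f g (suc zero)    = swap (f 0) (g 1) (f 1) (g 0)
  where
  swap : ∀ a b c d → a ℤ.* b ℤ.+ c ℤ.* d ≡ d ℤ.* c ℤ.+ b ℤ.* a
  swap = ℤ-solve
⊛-comm f g (suc (suc n)) = begin
    f 0 ℤ.* g (2 + n) ℤ.+ (tail f ⊛ g) (suc n)
  ≡⟨ cong (ℤ._+_ (f 0 ℤ.* g (2 + n))) (⊛-comm (tail f) g (suc n)) ⟩
    f 0 ℤ.* g (2 + n) ℤ.+ (g 0 ℤ.* f (2 + n) ℤ.+ (tail g ⊛ tail f) n)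
  ≡⟨ cong (λ z → f 0 ℤ.* g (2 + n) ℤ.+ (g 0 ℤ.* f (2 + n) ℤ.+ z)) (⊛-comm (tail g) (tail f) n) ⟩
    f 0 ℤ.* g (2 + n) ℤ.+ (g 0 ℤ.* f (2 + n) ℤ.+ (tail f ⊛ tail g) n)
  ≡⟨ exchange (f 0 ℤ.* g (2 + n)) (g 0 ℤ.* f (2 + n)) _ ⟩
    g 0 ℤ.* f (2 + n) ℤ.+ (f 0 ℤ.* g (2 + n) ℤ.+ (tail f ⊛ tail g) n)
  ≡⟨ cong (ℤ._+_ (g 0 ℤ.* f (2 + n))) (⊛-comm f (tail g) (suc n)) ⟩
    g 0 ℤ.* f (2 + n) ℤ.+ (tail g ⊛ f) (suc n) ∎
  where
  open ≡-Reasoning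
  exchange : ∀ a b x → a ℤ.+ (b ℤ.+ x) ≡ b ℤ.+ (a ℤ.+ x)
  exchange = ℤ-solve

-- Associativity, using tail (f ⊛ g) = f 0 · tail g + tail f ⊛ g.
⊛-assoc : ∀ f g h → (f ⊛ g) ⊛ h ≗ f ⊛ (g ⊛ h)
⊛-assoc f g h zero    = ℤP.*-assoc (f 0) (g 0) (h 0)
⊛-assoc f g h (suc n) = begin
    f 0 ℤ.* g 0 ℤ.* h (suc n) ℤ.+ (tail (f ⊛ g) ⊛ h) n
  ≡⟨ cong (ℤ._+_ (f 0 ℤ.* g 0 ℤ.* h (suc n))) (⊛-distribʳ-+ (f 0 ·ₛ tail g) (tail f ⊛ g) h n) ⟩
    f 0 ℤ.* g 0 ℤ.* h (suc n) ℤ.+ (((f 0 ·ₛ tail g) ⊛ h) n ℤ.+ ((tail f ⊛ g) ⊛ h) n)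
  ≡⟨ cong₂ (λ a b → f 0 ℤ.* g 0 ℤ.* h (suc n) ℤ.+ (a ℤ.+ b))
           (⊛-scaleˡ (f 0) (tail g) h n) (⊛-assoc (tail f) g h n) ⟩
    f 0 ℤ.* g 0 ℤ.* h (suc n) ℤ.+ (f 0 ℤ.* (tail g ⊛ h) n ℤ.+ (tail f ⊛ (g ⊛ h)) n)
  ≡⟨ factor (f 0) (g 0) (h (suc n)) ((tail g ⊛ h) n) ((tail f ⊛ (g ⊛ h)) n) ⟩
    f 0 ℤ.* (g 0 ℤ.* h (suc n) ℤ.+ (tail g ⊛ h) n) ℤ.+ (tail f ⊛ (g ⊛ h)) n ∎
  where
  open ≡-Reasoning
  factor : ∀ a b c x y → a ℤ.* b ℤ.* c ℤ.+ (a ℤ.* x ℤ.+ y) ≡ a ℤ.* (b ℤ.* c ℤ.+ x) ℤ.+ y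
  factor = ℤ-solve

⊛-interchange : ∀ a b c e → (a ⊛ b) ⊛ (c ⊛ e) ≗ (a ⊛ c) ⊛ (b ⊛ e)
⊛-interchange a b c e = begin
    (a ⊛ b) ⊛ (c ⊛ e)  ≈⟨ ⊛-assoc a b (c ⊛ e) ⟩
    a ⊛ (b ⊛ (c ⊛ e))  ≈⟨ ⊛-cong {a} (λ _ → refl) (λ n → sym (⊛-assoc b c e n)) ⟩
    a ⊛ ((b ⊛ c) ⊛ e)  ≈⟨ ⊛-cong {a} (λ _ → refl) (⊛-cong (⊛-comm b c) (λ _ → refl)) ⟩
    a ⊛ ((c ⊛ b) ⊛ e)  ≈⟨ ⊛-cong {a} (λ _ → refl) (⊛-assoc c b e) ⟩
    a ⊛ (c ⊛ (b ⊛ e))  ≈⟨ ⊛-assoc a c (b ⊛ e) ⟨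
    (a ⊛ c) ⊛ (b ⊛ e)  ∎
  where open ≗-Reasoning

q^_·_ : ℕ → Series → Series
(q^ zero  · f) n       = f n
(q^ suc k · f) zero    = 0ℤ
(q^ suc k · f) (suc n) = (q^ k · f) n

q^·-cong : ∀ k {f g} → f ≗ g → q^ k · f ≗ q^ k · g
q^·-cong zero    f≗g n       = f≗g n
q^·-cong (suc k) f≗g zero    = refl
q^·-cong (suc k) f≗g (suc n) = q^·-cong k f≗g n

q^·-+ : ∀ a b f → q^ a · (q^ b · f) ≗ q^ (a + b) · f
q^·-+ zero    b f n       = refl
q^·-+ (suc a) b f zero    = refl
q^·-+ (suc a) b f (suc n) = q^·-+ a b f n

q^·-⊛ : ∀ k f g → (q^ k · f) ⊛ g ≗ q^ k · (f ⊛ g)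
q^·-⊛ zero    f g n       = refl
q^·-⊛ (suc k) f g zero    = ℤP.*-zeroˡ (g 0)
q^·-⊛ (suc k) f g (suc n) =
  trans (cong (ℤ._+ ((q^ k · f) ⊛ g) n) (ℤP.*-zeroˡ (g (suc n))))
        (trans (ℤP.+-identityˡ _) (q^·-⊛ k f g n))

⊛-q^· : ∀ k f g → f ⊛ (q^ k · g) ≗ q^ k · (f ⊛ g)
⊛-q^· k f g n = trans (⊛-comm f (q^ k · g) n)
                 (trans (q^·-⊛ k g f n) (q^·-cong k (⊛-comm g f) n))

q^·-char : ∀ c g h → (∀ n → n < c → g n ≡ 0ℤ) → (∀ n → g (c + n) ≡ h n) → g ≗ q^ c · h
q^·-char zero    g h low high n       = high n
q^·-char (suc c) g h low high zero    = low 0 (s≤s z≤n)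
q^·-char (suc c) g h low high (suc n) =
  q^·-char c (tail g) h (λ m m<c → low (suc m) (s≤s m<c)) high n

qPow≗q^·oneₛ : ∀ k → qPow k ≗ q^ k · oneₛ
qPow≗q^·oneₛ zero    zero    = refl
qPow≗q^·oneₛ zero    (suc n) = refl
qPow≗q^·oneₛ (suc k) zero    = refl
qPow≗q^·oneₛ (suc k) (suc n) = qPow≗q^·oneₛ k n

qPow-⊛ : ∀ k g → qPow k ⊛ g ≗ q^ k · g
qPow-⊛ k g n = trans (⊛-cong (qPow≗q^·oneₛ k) (λ _ → refl) n)
                (trans (q^·-⊛ k oneₛ g n) (q^·-cong k (⊛-identityˡ g) n))

q^·-qPow : ∀ a b → q^ a · qPow b ≗ qPow (a + b)
q^·-qPow a b n = trans (q^·-cong a (qPow≗q^·oneₛ b) n)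
                  (trans (q^·-+ a b oneₛ n) (sym (qPow≗q^·oneₛ (a + b) n)))

invList≡reversed : ∀ f n → invList f n ≡ applyUpTo (λ k → invₛ f (n ∸ k)) (suc n)
invList≡reversed f zero    = refl
invList≡reversed f (suc n) = cong (invₛ f (suc n) ∷_) (invList≡reversed f n)

zipWith-applyUpTo : ∀ {A B C : Set} (_∙_ : A → B → C) (a : ℕ → A) (b : ℕ → B) m →
  zipWith _∙_ (applyUpTo a m) (applyUpTo b m) ≡ applyUpTo (λ k → a k ∙ b k) m
zipWith-applyUpTo _∙_ a b zero    = refl
zipWith-applyUpTo _∙_ a b (suc m) =
  cong (a 0 ∙ b 0 ∷_) (zipWith-applyUpTo _∙_ (a ∘ suc) (b ∘ suc) m)

invₛ-suc : ∀ f n → invₛ f (suc n) ≡ - (tail f ⊛ invₛ f) n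
invₛ-suc f n = cong -_ (begin
    sumℤ (zipWith ℤ._*_ (map (tail f) (upTo (suc n))) (invList f n))
  ≡⟨ cong₂ (λ xs ys → sumℤ (zipWith ℤ._*_ xs ys))
           (List.map-upTo (tail f) (suc n)) (invList≡reversed f n) ⟩
    sumℤ (zipWith ℤ._*_ (applyUpTo (tail f) (suc n))
                        (applyUpTo (λ k → invₛ f (n ∸ k)) (suc n)))
  ≡⟨ cong sumℤ (zipWith-applyUpTo ℤ._*_ (tail f) (λ k → invₛ f (n ∸ k)) (suc n)) ⟩
    sumℤ (applyUpTo (λ k → tail f k ℤ.* invₛ f (n ∸ k)) (suc n))
  ≡⟨ convolution-sum (tail f) (invₛ f) n ⟩
    (tail f ⊛ invₛ f) n ∎)
  where open ≡-Reasoning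

⊛-invₛ : ∀ f → f 0 ≡ 1ℤ → f ⊛ invₛ f ≗ oneₛ
⊛-invₛ f f0≡1 zero    = cong (ℤ._* 1ℤ) f0≡1
⊛-invₛ f f0≡1 (suc n) = begin
    f 0 ℤ.* invₛ f (suc n) ℤ.+ (tail f ⊛ invₛ f) n
  ≡⟨ cong₂ (λ a b → a ℤ.* b ℤ.+ (tail f ⊛ invₛ f) n) f0≡1 (invₛ-suc f n) ⟩
    1ℤ ℤ.* (- (tail f ⊛ invₛ f) n) ℤ.+ (tail f ⊛ invₛ f) n
  ≡⟨ cancel ((tail f ⊛ invₛ f) n) ⟩
    0ℤ ∎
  where
  open ≡-Reasoning
  cancel : ∀ x → 1ℤ ℤ.* (- x) ℤ.+ x ≡ 0ℤ
  cancel = ℤ-solve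

divide : ∀ D F G → D 0 ≡ 1ℤ → D ⊛ F ≗ G → F ≗ G *ₛ invₛ D
divide D F G D0≡1 DF≗G = begin
    F                        ≈⟨ ⊛-identityˡ F ⟨
    oneₛ ⊛ F                 ≈⟨ ⊛-cong (⊛-invₛ D D0≡1) (λ _ → refl) ⟨
    (D ⊛ invₛ D) ⊛ F         ≈⟨ ⊛-cong (⊛-comm D (invₛ D)) (λ _ → refl) ⟩
    (invₛ D ⊛ D) ⊛ F         ≈⟨ ⊛-assoc (invₛ D) D F ⟩
    invₛ D ⊛ (D ⊛ F)         ≈⟨ ⊛-cong {invₛ D} (λ _ → refl) DF≗G ⟩
    invₛ D ⊛ G               ≈⟨ ⊛-comm (invₛ D) G ⟩
    G ⊛ invₛ D               ≈⟨ *ₛ≗⊛ G (invₛ D) ⟨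
    G *ₛ invₛ D              ∎
  where open ≗-Reasoning

count : {I : Set} → List I → (I → ℕ) → (I → ℕ) → ℕ → ℕ
count xs μ w n = ΣL xs (λ i → μ i * χ (w i ≡ᵇ n))

<⇒≡ᵇ-false : ∀ {a n} → n < a → (a ≡ᵇ n) ≡ false
<⇒≡ᵇ-false {suc a} {zero}  n<a       = refl
<⇒≡ᵇ-false {suc a} {suc n} (s≤s n<a) = <⇒≡ᵇ-false n<a

≡ᵇ-cancelˡ : ∀ c a n → (c + a ≡ᵇ c + n) ≡ (a ≡ᵇ n)
≡ᵇ-cancelˡ zero    a n = refl
≡ᵇ-cancelˡ (suc c) a n = ≡ᵇ-cancelˡ c a n

record Exhaustive {I : Set} (box : ℕ → List I) (w : I → ℕ) : Set where
  field
    stable : ∀ B k f → (∀ i → B < w i → f i ≡ 0) → ΣL (box (B + k)) f ≡ ΣL (box B) f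

count-stable : ∀ {I : Set} {box : ℕ → List I} {w} → Exhaustive box w →
  ∀ μ {n B} → n ≤ B → count (box B) μ w n ≡ count (box n) μ w n
count-stable {box = box} {w} exhaustive μ {n} {B} n≤B =
  trans (cong (λ b → count (box b) μ w n) (sym (m+[n∸m]≡n n≤B)))
        (Exhaustive.stable exhaustive n (B ∸ n) _ (λ i n<wi →
          trans (cong (λ b → μ i * χ b) (<⇒≡ᵇ-false n<wi)) (*-zeroʳ (μ i))))

gf : {I : Set} → (ℕ → List I) → (I → ℕ) → (I → ℕ) → Series
gf box μ w n = ℤ.+ count (box n) μ w n

gf-offset : ∀ {I : Set} {box : ℕ → List I} {w} → Exhaustive box w →
  ∀ μ c → gf box μ (λ i → c + w i) ≗ q^ c · gf box μ w
gf-offset {box = box} {w} exhaustive μ c = q^·-char c _ _ below above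
  where
  below : ∀ n → n < c → gf box μ (λ i → c + w i) n ≡ 0ℤ
  below n n<c = cong ℤ.+_ (ΣL-zero (box n) _ (λ i →
    trans (cong (λ b → μ i * χ b) (<⇒≡ᵇ-false (<-≤-trans n<c (m≤m+n c (w i))))) (*-zeroʳ (μ i))))
  above : ∀ n → gf box μ (λ i → c + w i) (c + n) ≡ gf box μ w n
  above n = cong ℤ.+_ (trans
    (ΣL-cong (box (c + n)) (λ i → cong (λ b → μ i * χ b) (≡ᵇ-cancelˡ c (w i) n)))
    (count-stable exhaustive μ (m≤n+m n c)))

vectors-exhaustive : ∀ d → Exhaustive (allVecs d) sumV
vectors-exhaustive d = record { stable = ΣV-bound d }

pairs : (d B : ℕ) → List (Vec ℕ d × Vec ℕ d)
pairs d B = cartesianProduct (allVecs d B) (allVecs d B)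

pairWeight : ∀ {d} → Vec ℕ d × Vec ℕ d → ℕ
pairWeight p = sumV (proj₁ p) + sumV (proj₂ p)

pairs-exhaustive : ∀ d → Exhaustive (pairs d) pairWeight
pairs-exhaustive d = record { stable = stable }
  where
  stable : ∀ B k f → (∀ p → B < pairWeight p → f p ≡ 0) → ΣL (pairs d (B + k)) f ≡ ΣL (pairs d B) f
  stable B k f f≡0 = begin
      ΣL (pairs d (B + k)) f
    ≡⟨ ΣL-cartesianProduct (allVecs d (B + k)) _ f ⟩
      ΣV d (B + k) (λ x → ΣV d (B + k) (λ y → f (x , y)))
    ≡⟨ ΣL-cong (allVecs d (B + k)) (λ x → ΣV-bound d B k _ (λ y B<y →
         f≡0 (x , y) (<-≤-trans B<y (m≤n+m (sumV y) (sumV x))))) ⟩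
      ΣV d (B + k) (λ x → ΣV d B (λ y → f (x , y)))
    ≡⟨ ΣV-bound d B k _ (λ x B<x → ΣL-zero (allVecs d B) _ (λ y →
         f≡0 (x , y) (<-≤-trans B<x (m≤m+n (sumV x) (sumV y))))) ⟩
      ΣV d B (λ x → ΣV d B (λ y → f (x , y)))
    ≡⟨ ΣL-cartesianProduct (allVecs d B) _ f ⟨
      ΣL (pairs d B) f ∎
    where open ≡-Reasoning

-- Strictly decreasing vectors, i.e. partitions into d distinct non-negative parts.
strict : ∀ {d} → Vec ℕ d → ℕ
strict v = χ (strictDecᵇ v)

distinct : ℕ → Series
distinct d = gf (allVecs d) strict sumV

distinctCount : ℕ → ℕ → ℕ
distinctCount d n = count (allVecs d n) strict sumV n

-- Splitting off the last part: a strictly decreasing v ∈ ℕ^(d+1) either has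
-- only positive parts (v = 1 + u, |v| = d + 1 + |u|) or ends in 0 with
-- positive parts before it (v = (1 + u) ++ [0], |v| = d + |u|).
module DistinctSplit (d n : ℕ) where

  offsetCount : (e c : ℕ) → ℕ
  offsetCount e c = count (allVecs e n) strict (λ v → c + sumV v) n

  private
    f : Vec ℕ (suc d) → ℕ
    f v = strict v * χ (sumV v ≡ᵇ n)

  positive-parts : ΣV (suc d) (suc n) (λ v → f v * χ (noZero v)) ≡ offsetCount (suc d) (suc d)
  positive-parts =
    trans (ΣV-shift (suc d) n _ (λ v zero∈v → trans (cong (λ b → f v * χ b) zero∈v) (*-zeroʳ (f v))))
          (ΣL-cong (allVecs (suc d) n) lowered)
    where
    lowered : ∀ u → f (Vec.map suc u) * χ (noZero (Vec.map suc u)) ≡ strict u * χ (suc d + sumV u ≡ᵇ n)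
    lowered u rewrite strictDecᵇ-map-suc u | sumV-map-suc u | noZero-map-suc u = *-identityʳ _

  last-part-zero : ΣV (suc d) (suc n) (λ v → f v * χ (not (noZero v))) ≡ offsetCount d d
  last-part-zero = begin
      ΣV (suc d) (suc n) g
    ≡⟨ ΣV-snoc d (suc n) g ⟩
      Σ< (suc (suc n)) (λ j → ΣV d (suc n) (λ u → g (u ∷ʳ j)))
    ≡⟨ Σ<-head (suc n) (λ j → ΣV d (suc n) (λ u → g (u ∷ʳ j)))
               (λ j → ΣL-zero (allVecs d (suc n)) _ (g-snoc-suc j)) ⟩
      ΣV d (suc n) (λ u → g (u ∷ʳ 0))
    ≡⟨ ΣL-cong (allVecs d (suc n)) g-snoc-0 ⟩
      ΣV d (suc n) h
    ≡⟨ ΣV-shift d n h h-noZero ⟩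
      ΣV d n (h ∘ Vec.map suc)
    ≡⟨ ΣL-cong (allVecs d n) h-lowered ⟩
      offsetCount d d ∎
    where
    open ≡-Reasoning
    g : Vec ℕ (suc d) → ℕ
    g v = f v * χ (not (noZero v))
    h : Vec ℕ d → ℕ
    h u = strict u * χ (noZero u) * χ (sumV u ≡ᵇ n)

    g-snoc-suc : ∀ j u → g (u ∷ʳ suc j) ≡ 0
    g-snoc-suc j u with strictDecᵇ (u ∷ʳ suc j) in dec
    ... | false = refl
    ... | true  rewrite strictDecᵇ-snoc-suc u j dec = *-zeroʳ (1 * χ (sumV (u ∷ʳ suc j) ≡ᵇ n))

    g-snoc-0 : ∀ u → g (u ∷ʳ 0) ≡ h u
    g-snoc-0 u rewrite strictDecᵇ-snoc-0 u | noZero-snoc-0 u | sumV-snoc u 0 | +-identityʳ (sumV u) =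
      trans (*-identityʳ _) (cong (_* χ (sumV u ≡ᵇ n)) (χ-∧ (strictDecᵇ u) (noZero u)))

    h-noZero : ∀ u → noZero u ≡ false → h u ≡ 0
    h-noZero u zero∈u rewrite zero∈u = cong (_* χ (sumV u ≡ᵇ n)) (*-zeroʳ (strict u))

    h-lowered : ∀ u → h (Vec.map suc u) ≡ strict u * χ (d + sumV u ≡ᵇ n)
    h-lowered u rewrite strictDecᵇ-map-suc u | noZero-map-suc u | sumV-map-suc u =
      cong (_* χ (d + sumV u ≡ᵇ n)) (*-identityʳ (strict u))

  distinct-split : distinctCount (suc d) n ≡ offsetCount (suc d) (suc d) + offsetCount d d
  distinct-split = begin
      distinctCount (suc d) n
    ≡⟨ count-stable (vectors-exhaustive (suc d)) strict (n≤1+n n) ⟨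
      ΣV (suc d) (suc n) f
    ≡⟨ ΣL-cong (allVecs (suc d) (suc n)) (λ v → split-χ (f v) (noZero v)) ⟩
      ΣV (suc d) (suc n) (λ v → f v * χ (noZero v) + f v * χ (not (noZero v)))
    ≡⟨ ΣL-+ (allVecs (suc d) (suc n)) _ _ ⟩
      ΣV (suc d) (suc n) (λ v → f v * χ (noZero v))
        + ΣV (suc d) (suc n) (λ v → f v * χ (not (noZero v)))
    ≡⟨ cong₂ _+_ positive-parts last-part-zero ⟩
      offsetCount (suc d) (suc d) + offsetCount d d ∎
    where open ≡-Reasoning

distinct-recursion : ∀ d → distinct (suc d) ≗ q^ suc d · distinct (suc d) +ₛ q^ d · distinct d
distinct-recursion d n = begin
    distinct (suc d) n
  ≡⟨ cong ℤ.+_ distinct-split ⟩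
    ℤ.+ (offsetCount (suc d) (suc d) + offsetCount d d)
  ≡⟨ ℤP.pos-+ (offsetCount (suc d) (suc d)) (offsetCount d d) ⟩
    gf (allVecs (suc d)) strict (λ v → suc d + sumV v) n ℤ.+ gf (allVecs d) strict (λ u → d + sumV u) n
  ≡⟨ cong₂ ℤ._+_ (gf-offset (vectors-exhaustive (suc d)) strict (suc d) n)
                 (gf-offset (vectors-exhaustive d) strict d n) ⟩
    (q^ suc d · distinct (suc d)) n ℤ.+ (q^ d · distinct d) n ∎
  where
  open ≡-Reasoning
  open DistinctSplit d n

distinct-step : ∀ d → (oneₛ -ₛ qPow (suc d)) ⊛ distinct (suc d) ≗ q^ d · distinct d
distinct-step d n = begin
    ((oneₛ -ₛ qPow (suc d)) ⊛ distinct (suc d)) n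
  ≡⟨ ⊛-distribʳ-- oneₛ (qPow (suc d)) (distinct (suc d)) n ⟩
    (oneₛ ⊛ distinct (suc d)) n ℤ.- (qPow (suc d) ⊛ distinct (suc d)) n
  ≡⟨ cong₂ ℤ._-_ (trans (⊛-identityˡ (distinct (suc d)) n) (distinct-recursion d n))
                 (qPow-⊛ (suc d) (distinct (suc d)) n) ⟩
    (q^ suc d · distinct (suc d)) n ℤ.+ (q^ d · distinct d) n ℤ.- (q^ suc d · distinct (suc d)) n
  ≡⟨ cancel ((q^ suc d · distinct (suc d)) n) _ ⟩
    (q^ d · distinct d) n ∎
  where
  open ≡-Reasoning
  cancel : ∀ a b → a ℤ.+ b ℤ.- a ≡ b
  cancel = ℤ-solve

triangle : ℕ → ℕ
triangle zero    = 0
triangle (suc d) = d + triangle d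

triangle-square : ∀ d → d + (triangle d + triangle d) ≡ d * d
triangle-square zero    = refl
triangle-square (suc d) = begin
    suc d + ((d + triangle d) + (d + triangle d))  ≡⟨ cong suc (regroup d (triangle d)) ⟩
    suc (d + d + (d + (triangle d + triangle d)))  ≡⟨ cong (λ t → suc (d + d + t)) (triangle-square d) ⟩
    suc (d + d + d * d)                            ≡⟨ square d ⟩
    suc d * suc d                                  ∎
  where
  open ≡-Reasoning
  regroup : ∀ d t → d + ((d + t) + (d + t)) ≡ d + d + (d + (t + t))
  regroup = ℕ-solve
  square : ∀ d → suc (d + d + d * d) ≡ suc d * suc d
  square = ℕ-solve

qPoch-distinct : ∀ d → qPoch d ⊛ distinct d ≗ qPow (triangle d)
qPoch-distinct zero = begin
    oneₛ ⊛ distinct 0  ≈⟨ ⊛-identityˡ (distinct 0) ⟩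
    distinct 0         ≈⟨ distinct-0 ⟩
    qPow 0             ∎
  where
  open ≗-Reasoning
  distinct-0 : distinct 0 ≗ qPow 0
  distinct-0 zero    = refl
  distinct-0 (suc n) = refl
qPoch-distinct (suc d) = begin
    (qPoch d *ₛ (oneₛ -ₛ qPow (suc d))) ⊛ distinct (suc d)
  ≈⟨ ⊛-cong (*ₛ≗⊛ (qPoch d) (oneₛ -ₛ qPow (suc d))) (λ _ → refl) ⟩
    (qPoch d ⊛ (oneₛ -ₛ qPow (suc d))) ⊛ distinct (suc d)
  ≈⟨ ⊛-assoc (qPoch d) (oneₛ -ₛ qPow (suc d)) (distinct (suc d)) ⟩
    qPoch d ⊛ ((oneₛ -ₛ qPow (suc d)) ⊛ distinct (suc d))
  ≈⟨ ⊛-cong {qPoch d} (λ _ → refl) (distinct-step d) ⟩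
    qPoch d ⊛ (q^ d · distinct d)
  ≈⟨ ⊛-q^· d (qPoch d) (distinct d) ⟩
    q^ d · (qPoch d ⊛ distinct d)
  ≈⟨ q^·-cong d (qPoch-distinct d) ⟩
    q^ d · qPow (triangle d)
  ≈⟨ q^·-qPow d (triangle d) ⟩
    qPow (d + triangle d) ∎
  where open ≗-Reasoning

symbol : ∀ {d} → (Vec ℕ d → Vec ℕ d → Bool) → Vec ℕ d × Vec ℕ d → ℕ
symbol L p = strict (proj₁ p) * strict (proj₂ p) * χ (L (proj₁ p) (proj₂ p))

-- Σ q^(|x|+|y|) over such pairs: the Frobenius generating function without
-- the d dots of the diagonal.
symbols : (d : ℕ) → (Vec ℕ d → Vec ℕ d → Bool) → Series
symbols d L = gf (pairs d) (symbol L) pairWeight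

symbolCount : (d : ℕ) → (Vec ℕ d → Vec ℕ d → Bool) → ℕ → ℕ
symbolCount d L n = count (pairs d n) (symbol L) pairWeight n

frobSymbols-count : ∀ n d (L : Vec ℕ d → Vec ℕ d → Bool) →
  length (filterᵇ (λ p → L (proj₁ p) (proj₂ p)) (frobSymbols n d))
    ≡ count (pairs d n) (symbol L) (λ p → d + pairWeight p) n
frobSymbols-count n d L = begin
    length (filterᵇ L′ (frobSymbols n d))
  ≡⟨ length≡ΣL (filterᵇ L′ (frobSymbols n d)) ⟩
    ΣL (filterᵇ L′ (frobSymbols n d)) (λ _ → 1)
  ≡⟨ ΣL-filter L′ (frobSymbols n d) (λ _ → 1) ⟩
    ΣL (frobSymbols n d) (λ p → χ (L′ p) * 1)
  ≡⟨ ΣL-filter (isFrobᵇ n) (pairs d n) (λ p → χ (L′ p) * 1) ⟩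
    ΣL (pairs d n) (λ p → χ (isFrobᵇ n p) * (χ (L′ p) * 1))
  ≡⟨ ΣL-cong (pairs d n) (λ p → indicator (proj₁ p) (proj₂ p)) ⟩
    count (pairs d n) (symbol L) (λ p → d + pairWeight p) n ∎
  where
  open ≡-Reasoning
  L′ : Vec ℕ d × Vec ℕ d → Bool
  L′ p = L (proj₁ p) (proj₂ p)
  reorder : ∀ a b e l → a * (b * e) * (l * 1) ≡ a * b * l * e
  reorder = ℕ-solve
  indicator : ∀ x y → χ (isFrobᵇ n (x , y)) * (χ (L x y) * 1)
                    ≡ symbol L (x , y) * χ (d + pairWeight (x , y) ≡ᵇ n)
  indicator x y = begin
      χ (strictDecᵇ x ∧ strictDecᵇ y ∧ (weight x y ≡ᵇ n)) * (χ (L x y) * 1)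
    ≡⟨ cong (_* (χ (L x y) * 1))
         (trans (χ-∧ (strictDecᵇ x) _) (cong (strict x *_) (χ-∧ (strictDecᵇ y) _))) ⟩
      strict x * (strict y * χ (weight x y ≡ᵇ n)) * (χ (L x y) * 1)
    ≡⟨ reorder (strict x) (strict y) _ (χ (L x y)) ⟩
      symbol L (x , y) * χ (sumV x + sumV y + d ≡ᵇ n)
    ≡⟨ cong (λ t → symbol L (x , y) * χ (t ≡ᵇ n)) (+-comm (sumV x + sumV y) d) ⟩
      symbol L (x , y) * χ (d + pairWeight (x , y) ≡ᵇ n) ∎

symbols-frobenius : ∀ d L n →
  ℤ.+ length (filterᵇ (λ p → L (proj₁ p) (proj₂ p)) (frobSymbols n d)) ≡ (q^ d · symbols d L) n
symbols-frobenius d L n =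
  trans (cong ℤ.+_ (frobSymbols-count n d L)) (gf-offset (pairs-exhaustive d) (symbol L) d n)

genPlus-symbols : ∀ d → genPlus (suc d) ≗ q^ suc d · symbols (suc d) lastPositiveᵇ
genPlus-symbols d zero    = refl
genPlus-symbols d (suc n) = symbols-frobenius (suc d) lastPositiveᵇ (suc n)

genMinus-symbols : ∀ d → genMinus (suc d) ≗ q^ suc d · symbols (suc d) lastNegativeᵇ
genMinus-symbols d zero    = refl
genMinus-symbols d (suc n) = symbols-frobenius (suc d) lastNegativeᵇ (suc n)

-- The bijection (x , y) ↦ (y , x − 1) between symbols with positive last
-- column and symbols with negative last column, lowering |x|+|y| by d + 1.
module PositiveShift (d n : ℕ) where

  private
    D = suc d

    P : Vec ℕ D → Vec ℕ D → ℕ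
    P x y = symbol lastPositiveᵇ (x , y) * χ (pairWeight (x , y) ≡ᵇ n)

    N : Vec ℕ D → Vec ℕ D → ℕ
    N y x = symbol lastNegativeᵇ (y , x) * χ (D + pairWeight (y , x) ≡ᵇ n)

    P-noZero : ∀ x y → noZero x ≡ false → P x y ≡ 0
    P-noZero x y zero∈x with strictDecᵇ x in dec
    ... | false = refl
    ... | true rewrite lastPositive-noZero x y dec zero∈x =
      cong (_* χ (pairWeight (x , y) ≡ᵇ n)) (*-zeroʳ (1 * strict y))

    P-lowered : ∀ x y → P (Vec.map suc x) y ≡ N y x
    P-lowered x y rewrite strictDecᵇ-map-suc x | sumV-map-suc x | lastPositive-map-suc x y =
      cong₂ (λ a b → a * χ (lastNegativeᵇ y x) * χ (b ≡ᵇ n))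
            (*-comm (strict x) (strict y)) (exchange D (sumV x) (sumV y))
      where
      exchange : ∀ c a b → c + a + b ≡ c + (b + a)
      exchange = ℕ-solve

    N-bound : ∀ x y → n < sumV y → N y x ≡ 0
    N-bound x y n<y = trans
      (cong (λ b → symbol lastNegativeᵇ (y , x) * χ b)
            (<⇒≡ᵇ-false (<-≤-trans n<y (≤-trans (m≤m+n (sumV y) (sumV x)) (m≤n+m _ D)))))
      (*-zeroʳ (symbol lastNegativeᵇ (y , x)))

  positive-shift :
    symbolCount D lastPositiveᵇ n ≡ count (pairs D n) (symbol lastNegativeᵇ) (λ p → D + pairWeight p) n
  positive-shift = begin
      symbolCount D lastPositiveᵇ n
    ≡⟨ count-stable (pairs-exhaustive D) (symbol lastPositiveᵇ) (n≤1+n n) ⟨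
      count (pairs D (suc n)) (symbol lastPositiveᵇ) pairWeight n
    ≡⟨ ΣL-cartesianProduct (allVecs D (suc n)) _ _ ⟩
      ΣV D (suc n) (λ x → ΣV D (suc n) (P x))
    ≡⟨ ΣV-shift D n _ (λ x zero∈x → ΣL-zero (allVecs D (suc n)) _ (λ y → P-noZero x y zero∈x)) ⟩
      ΣV D n (λ x → ΣV D (suc n) (P (Vec.map suc x)))
    ≡⟨ ΣL-cong (allVecs D n) (λ x → ΣL-cong (allVecs D (suc n)) (P-lowered x)) ⟩
      ΣV D n (λ x → ΣV D (suc n) (λ y → N y x))
    ≡⟨ ΣL-cong (allVecs D n) (λ x →
         trans (cong (λ b → ΣV D b (λ y → N y x)) (+-comm 1 n)) (ΣV-bound D n 1 _ (N-bound x))) ⟩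
      ΣV D n (λ x → ΣV D n (λ y → N y x))
    ≡⟨ ΣL-swap (allVecs D n) (allVecs D n) (λ x y → N y x) ⟩
      ΣV D n (λ y → ΣV D n (λ x → N y x))
    ≡⟨ ΣL-cartesianProduct (allVecs D n) _ _ ⟨
      count (pairs D n) (symbol lastNegativeᵇ) (λ p → D + pairWeight p) n ∎
    where open ≡-Reasoning

positive-negative : ∀ d → symbols (suc d) lastPositiveᵇ ≗ q^ suc d · symbols (suc d) lastNegativeᵇ
positive-negative d n =
  trans (cong ℤ.+_ (PositiveShift.positive-shift d n))
        (gf-offset (pairs-exhaustive (suc d)) (symbol lastNegativeᵇ) (suc d) n)

χ-sum : ∀ a b n → χ (a + b ≡ᵇ n) ≡ Σ< (suc n) (λ k → χ (a ≡ᵇ k) * χ (b ≡ᵇ n ∸ k))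
χ-sum zero    zero    zero    = refl
χ-sum zero    (suc b) zero    = refl
χ-sum (suc a) b       zero    = refl
χ-sum zero    b       (suc n) = sym (trans
  (cong₂ _+_ (*-identityˡ (χ (b ≡ᵇ suc n))) (Σ<-zero (suc n) _ (λ _ → refl)))
  (+-identityʳ _))
χ-sum (suc a) b       (suc n) = χ-sum a b n

-- Every symbol has a positive or a negative last column, and the two rows of
-- a symbol are independent strictly decreasing vectors: symbols⁺ + symbols⁻
-- = distinct².
module SignSplit (d n : ℕ) where

  private
    D = suc d

    A : Vec ℕ D → ℕ → ℕ
    A x k = strict x * χ (sumV x ≡ᵇ k)

    sign-split : ∀ (x y : Vec ℕ D) →
      symbol lastPositiveᵇ (x , y) * χ (pairWeight (x , y) ≡ᵇ n)
        + symbol lastNegativeᵇ (x , y) * χ (pairWeight (x , y) ≡ᵇ n)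
        ≡ strict x * strict y * χ (pairWeight (x , y) ≡ᵇ n)
    sign-split x y = begin
        s * χ (lastPositiveᵇ x y) * e + s * χ (lastNegativeᵇ x y) * e
      ≡⟨ factor s (χ (lastPositiveᵇ x y)) (χ (lastNegativeᵇ x y)) e ⟩
        s * (χ (lastPositiveᵇ x y) + χ (lastNegativeᵇ x y)) * e
      ≡⟨ cong (λ t → s * t * e) (lastPositive-or-lastNegative x y) ⟩
        s * 1 * e
      ≡⟨ cong (_* e) (*-identityʳ s) ⟩
        s * e ∎
      where
      open ≡-Reasoning
      s e : ℕ
      s = strict x * strict y
      e = χ (pairWeight (x , y) ≡ᵇ n)
      factor : ∀ s a b e → s * a * e + s * b * e ≡ s * (a + b) * e
      factor = ℕ-solve

    weight-split : ∀ (x y : Vec ℕ D) →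
      strict x * strict y * χ (pairWeight (x , y) ≡ᵇ n) ≡ Σ< (suc n) (λ k → A x k * A y (n ∸ k))
    weight-split x y = begin
        strict x * strict y * χ (sumV x + sumV y ≡ᵇ n)
      ≡⟨ cong (strict x * strict y *_) (χ-sum (sumV x) (sumV y) n) ⟩
        strict x * strict y * Σ< (suc n) (λ k → χ (sumV x ≡ᵇ k) * χ (sumV y ≡ᵇ n ∸ k))
      ≡⟨ Σ<-*ˡ (suc n) (strict x * strict y) (λ k → χ (sumV x ≡ᵇ k) * χ (sumV y ≡ᵇ n ∸ k)) ⟩
        Σ< (suc n) (λ k → strict x * strict y * (χ (sumV x ≡ᵇ k) * χ (sumV y ≡ᵇ n ∸ k)))
      ≡⟨ Σ<-cong (suc n) (λ k _ →
           interchange (strict x) (strict y) (χ (sumV x ≡ᵇ k)) (χ (sumV y ≡ᵇ n ∸ k))) ⟩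
        Σ< (suc n) (λ k → A x k * A y (n ∸ k)) ∎
      where
      open ≡-Reasoning
      interchange : ∀ a b c e → a * b * (c * e) ≡ a * c * (b * e)
      interchange = ℕ-solve

    -- Σ_x Σ_y A x k · A y (n−k) factorises, and each factor is a count that
    -- can be taken in the box of its own weight.
    factorise : ∀ k → k < suc n →
      ΣV D n (λ x → ΣV D n (λ y → A x k * A y (n ∸ k)))
        ≡ distinctCount D k * distinctCount D (n ∸ k)
    factorise k (s≤s k≤n) = begin
        ΣV D n (λ x → ΣV D n (λ y → A x k * A y (n ∸ k)))
      ≡⟨ ΣL-cong (allVecs D n) (λ x → ΣL-*ˡ (allVecs D n) (A x k) (λ y → A y (n ∸ k))) ⟨
        ΣV D n (λ x → A x k * count (allVecs D n) strict sumV (n ∸ k))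
      ≡⟨ ΣL-*ʳ (allVecs D n) _ (λ x → A x k) ⟨
        count (allVecs D n) strict sumV k * count (allVecs D n) strict sumV (n ∸ k)
      ≡⟨ cong₂ _*_ (count-stable (vectors-exhaustive D) strict k≤n)
                   (count-stable (vectors-exhaustive D) strict (m∸n≤m n k)) ⟩
        distinctCount D k * distinctCount D (n ∸ k) ∎
      where open ≡-Reasoning

  sign-total :
    symbolCount D lastPositiveᵇ n + symbolCount D lastNegativeᵇ n
      ≡ Σ< (suc n) (λ k → distinctCount D k * distinctCount D (n ∸ k))
  sign-total = begin
      symbolCount D lastPositiveᵇ n + symbolCount D lastNegativeᵇ n
    ≡⟨ ΣL-+ (pairs D n) (λ p → symbol lastPositiveᵇ p * e p) (λ p → symbol lastNegativeᵇ p * e p) ⟨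
      ΣL (pairs D n) (λ p → symbol lastPositiveᵇ p * e p + symbol lastNegativeᵇ p * e p)
    ≡⟨ ΣL-cong (pairs D n) (λ p → trans (sign-split (proj₁ p) (proj₂ p))
                                          (weight-split (proj₁ p) (proj₂ p))) ⟩
      ΣL (pairs D n) (λ p → Σ< (suc n) (λ k → A (proj₁ p) k * A (proj₂ p) (n ∸ k)))
    ≡⟨ ΣL-cartesianProduct (allVecs D n) (allVecs D n)
         (λ p → Σ< (suc n) (λ k → A (proj₁ p) k * A (proj₂ p) (n ∸ k))) ⟩
      ΣV D n (λ x → ΣV D n (λ y → Σ< (suc n) (λ k → A x k * A y (n ∸ k))))
    ≡⟨ ΣL-cong (allVecs D n) (λ x → ΣL-Σ<-swap (allVecs D n) (suc n) (λ y k → A x k * A y (n ∸ k))) ⟩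
      ΣV D n (λ x → Σ< (suc n) (λ k → ΣV D n (λ y → A x k * A y (n ∸ k))))
    ≡⟨ ΣL-Σ<-swap (allVecs D n) (suc n) (λ x k → ΣV D n (λ y → A x k * A y (n ∸ k))) ⟩
      Σ< (suc n) (λ k → ΣV D n (λ x → ΣV D n (λ y → A x k * A y (n ∸ k))))
    ≡⟨ Σ<-cong (suc n) factorise ⟩
      Σ< (suc n) (λ k → distinctCount D k * distinctCount D (n ∸ k)) ∎
    where
    open ≡-Reasoning
    e : Vec ℕ D × Vec ℕ D → ℕ
    e p = χ (pairWeight p ≡ᵇ n)

positive+negative : ∀ d →
  symbols (suc d) lastPositiveᵇ +ₛ symbols (suc d) lastNegativeᵇ ≗ distinct (suc d) ⊛ distinct (suc d)
positive+negative d n = begin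
    symbols (suc d) lastPositiveᵇ n ℤ.+ symbols (suc d) lastNegativeᵇ n
  ≡⟨ ℤP.pos-+ (symbolCount (suc d) lastPositiveᵇ n) _ ⟨
    ℤ.+ (symbolCount (suc d) lastPositiveᵇ n + symbolCount (suc d) lastNegativeᵇ n)
  ≡⟨ cong ℤ.+_ (SignSplit.sign-total d n) ⟩
    ℤ.+ Σ< (suc n) (λ k → distinctCount (suc d) k * distinctCount (suc d) (n ∸ k))
  ≡⟨ ⊛-ℕ (distinctCount (suc d)) (distinctCount (suc d)) n ⟨
    (distinct (suc d) ⊛ distinct (suc d)) n ∎
  where open ≡-Reasoning

-- (1 + q^(d+1)) symbols⁻ = symbols⁻ + symbols⁺ = distinct².
negative-symbols : ∀ d →
  (oneₛ +ₛ qPow (suc d)) ⊛ symbols (suc d) lastNegativeᵇ ≗ distinct (suc d) ⊛ distinct (suc d)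
negative-symbols d = begin
    (oneₛ +ₛ qPow (suc d)) ⊛ N
  ≈⟨ ⊛-distribʳ-+ oneₛ (qPow (suc d)) N ⟩
    oneₛ ⊛ N +ₛ qPow (suc d) ⊛ N
  ≈⟨ (λ n → cong₂ ℤ._+_ (⊛-identityˡ N n) (qPow-⊛ (suc d) N n)) ⟩
    N +ₛ q^ suc d · N
  ≈⟨ (λ n → trans (cong (ℤ._+_ (N n)) (sym (positive-negative d n)))
                  (ℤP.+-comm (N n) (symbols (suc d) lastPositiveᵇ n))) ⟩
    symbols (suc d) lastPositiveᵇ +ₛ N
  ≈⟨ positive+negative d ⟩
    distinct (suc d) ⊛ distinct (suc d) ∎
  where
  open ≗-Reasoning
  N : Series
  N = symbols (suc d) lastNegativeᵇ

denominator : ℕ → Series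
denominator d = qPoch d *ₛ qPoch d *ₛ (oneₛ +ₛ qPow d)

-- (q;q)_d² (1 + q^d) symbols⁻ = ((q;q)_d distinct d)² = q^(d(d−1)), for d ≥ 1.
denominator-symbols : ∀ d →
  denominator (suc d) ⊛ symbols (suc d) lastNegativeᵇ ≗ qPow (triangle (suc d) + triangle (suc d))
denominator-symbols d = begin
    denominator (suc d) ⊛ N
  ≈⟨ ⊛-cong (λ n → trans (*ₛ≗⊛ (P *ₛ P) E n) (⊛-cong (*ₛ≗⊛ P P) (λ _ → refl) n)) (λ _ → refl) ⟩
    ((P ⊛ P) ⊛ E) ⊛ N
  ≈⟨ ⊛-assoc (P ⊛ P) E N ⟩
    (P ⊛ P) ⊛ (E ⊛ N)
  ≈⟨ ⊛-cong {P ⊛ P} (λ _ → refl) (negative-symbols d) ⟩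
    (P ⊛ P) ⊛ (δ ⊛ δ)
  ≈⟨ ⊛-interchange P P δ δ ⟩
    (P ⊛ δ) ⊛ (P ⊛ δ)
  ≈⟨ ⊛-cong (qPoch-distinct (suc d)) (qPoch-distinct (suc d)) ⟩
    qPow T ⊛ qPow T
  ≈⟨ qPow-⊛ T (qPow T) ⟩
    q^ T · qPow T
  ≈⟨ q^·-qPow T T ⟩
    qPow (T + T) ∎
  where
  open ≗-Reasoning
  P E N δ : Series
  P = qPoch (suc d)
  E = oneₛ +ₛ qPow (suc d)
  N = symbols (suc d) lastNegativeᵇ
  δ = distinct (suc d)
  T : ℕ
  T = triangle (suc d)

⊛-q^·-qPow : ∀ D F a b → D ⊛ F ≗ qPow a → D ⊛ (q^ b · F) ≗ qPow (b + a)
⊛-q^·-qPow D F a b DF≗qᵃ = begin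
    D ⊛ (q^ b · F)  ≈⟨ ⊛-q^· b D F ⟩
    q^ b · (D ⊛ F)  ≈⟨ q^·-cong b DF≗qᵃ ⟩
    q^ b · qPow a   ≈⟨ q^·-qPow b a ⟩
    qPow (b + a)    ∎
  where open ≗-Reasoning

-- (q;q)_d² (1 + q^d) Σ a⁻(n;d) qⁿ = q^d q^(d(d−1)) = q^(d²).
denominator-genMinus : ∀ d → denominator (suc d) ⊛ genMinus (suc d) ≗ qPow (suc d * suc d)
denominator-genMinus d = begin
    denominator (suc d) ⊛ genMinus (suc d)
  ≈⟨ ⊛-cong {denominator (suc d)} (λ _ → refl) (genMinus-symbols d) ⟩
    denominator (suc d) ⊛ (q^ suc d · symbols (suc d) lastNegativeᵇ)
  ≈⟨ ⊛-q^·-qPow _ _ _ (suc d) (denominator-symbols d) ⟩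
    qPow (suc d + (triangle (suc d) + triangle (suc d)))
  ≈⟨ (λ n → cong (λ a → qPow a n) (triangle-square (suc d))) ⟩
    qPow (suc d * suc d) ∎
  where open ≗-Reasoning

-- genPlus = q^d symbols⁺ = q^d q^d symbols⁻ = q^d genMinus.
denominator-genPlus : ∀ d → denominator (suc d) ⊛ genPlus (suc d) ≗ qPow (suc d * suc d + suc d)
denominator-genPlus d = begin
    denominator (suc d) ⊛ genPlus (suc d)
  ≈⟨ ⊛-cong {denominator (suc d)} (λ _ → refl) genPlus≗q^·genMinus ⟩
    denominator (suc d) ⊛ (q^ suc d · genMinus (suc d))
  ≈⟨ ⊛-q^·-qPow _ _ _ (suc d) (denominator-genMinus d) ⟩
    qPow (suc d + suc d * suc d)
  ≈⟨ (λ n → cong (λ a → qPow a n) (+-comm (suc d) (suc d * suc d))) ⟩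
    qPow (suc d * suc d + suc d) ∎
  where
  open ≗-Reasoning
  genPlus≗q^·genMinus : genPlus (suc d) ≗ q^ suc d · genMinus (suc d)
  genPlus≗q^·genMinus n = trans (genPlus-symbols d n)
    (q^·-cong (suc d) (λ m → trans (positive-negative d m) (sym (genMinus-symbols d m))) n)

qPoch-constant : ∀ d → qPoch d 0 ≡ 1ℤ
qPoch-constant zero    = refl
qPoch-constant (suc d) =
  trans (*ₛ≗⊛ (qPoch d) (oneₛ -ₛ qPow (suc d)) 0) (cong (ℤ._* 1ℤ) (qPoch-constant d))

denominator-constant : ∀ d → denominator (suc d) 0 ≡ 1ℤ
denominator-constant d =
  trans (*ₛ≗⊛ (qPoch (suc d) *ₛ qPoch (suc d)) (oneₛ +ₛ qPow (suc d)) 0)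
        (cong (ℤ._* 1ℤ) (trans (*ₛ≗⊛ (qPoch (suc d)) (qPoch (suc d)) 0)
                                (cong₂ ℤ._*_ (qPoch-constant (suc d)) (qPoch-constant (suc d)))))

theorem1p4 : (d : ℕ) → 1 ≤ d →
    ((n : ℕ) → genPlus d n
    ≡ (qPow (d * d + d) *ₛ invₛ (qPoch d *ₛ qPoch d *ₛ (oneₛ +ₛ qPow d))) n)
    × ((n : ℕ) → genMinus d n
    ≡ (qPow (d * d) *ₛ invₛ (qPoch d *ₛ qPoch d *ₛ (oneₛ +ₛ qPow d))) n)
theorem1p4 (suc d) _ =
    divide (denominator (suc d)) (genPlus (suc d)) _ (denominator-constant d) (denominator-genPlus d)
  , divide (denominator (suc d)) (genMinus (suc d)) _ (denominator-constant d) (denominator-genMinus d)
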